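{- Let $F$ be a QCL-formula and consider the game tree $T(\mathbf{P}:F)$ with its preference relation $\ll = \ll_{\mathbf{P}:F}$ on its set of leaves (outcomes) $\mathcal{O}(\mathbf{P}:F)$, as defined in the context for the QCL game $\mathbf{G}$. Then the maximum length $n$ of a sequence $O_1,\dots,O_n$ of pairwise distinct outcomes in $\mathcal{O}(\mathbf{P}:F)$ with $O_i \ll O_{i+1}$ for all $1\le i\le n-1$ equals $\mathrm{opt}(F)$.
   Context: QCL-formulas are built from propositional variables (from an infinite set $\mathcal{U}$) using $\neg$, $\wedge$, $\vee$ and the binary connective $\vec{\times}$ (ordered disjunction). Optionality: $\mathrm{opt}(a)=1$ for variables $a$; $\mathrm{opt}(\neg F)=1$; $\mathrm{opt}(F\circ G)=\max(\mathrm{opt}(F),\mathrm{opt}(G))$ for $\circ\in\{\wedge,\vee\}$; $\mathrm{opt}(F\vec{\times}G)=\mathrm{opt}(F)+\mathrm{opt}(G)$. Game trees: nodes are game states $\mathbf{Q}:H$ with $\mathbf{Q}\in\{\mathbf{P},\mathbf{O}\}$ (Me acting as proponent resp. opponent) and $H$ a formula; write $\bar{\mathbf{P}}=\mathbf{O}$, $\bar{\mathbf{O}}=\mathbf{P}$. $T(\mathbf{Q}:a)$ is a single leaf $\mathbf{Q}:a$. $T(\mathbf{Q}:\neg G)$ has root $\mathbf{Q}:\neg G$ with the single immediate subtree $T(\bar{\mathbf{Q}}:G)$. For $\circ\in\{\wedge,\vee,\vec{\times}\}$, $T(\mathbf{Q}:G_1\circ G_2)$ has root $\mathbf{Q}:G_1\circ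 G_2$ with immediate subtrees $T(\mathbf{Q}:G_1)$ and $T(\mathbf{Q}:G_2)$. The leaves of $T(\mathbf{Q}:F)$ are its outcomes $\mathcal{O}(\mathbf{Q}:F)$. The preference relation (from Me's viewpoint) on outcomes is defined by: $\ll_{\mathbf{P}:a}=\emptyset$; $\ll_{\mathbf{P}:\neg G}=\emptyset$; $\ll_{\mathbf{P}:G_1\wedge G_2}=\ll_{\mathbf{P}:G_1\vee G_2}=\ll_{\mathbf{P}:G_1}\cup\ll_{\mathbf{P}:G_2}$; $O_1\ll_{\mathbf{P}:G_1\vec{\times}G_2}O_2$ iff ($O_1\in\mathcal{O}(\mathbf{P}:G_2)$ and $O_2\in\mathcal{O}(\mathbf{P}:G_1)$) or $O_1\ll_{\mathbf{P}:G_j}O_2$ for some $j\in\{1,2\}$; and $\ll_{\mathbf{O}:F}=\emptyset$ for every formula $F$. -}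

module Defs where

open import Data.Nat using (ℕ; _+_; _⊔_)
open import Data.Empty using (⊥)
open import Data.Unit using (⊤)
open import Data.List using (List; length)
open import Data.List.Relation.Unary.Linked using (Linked)
open import Data.List.Relation.Unary.Unique.Propositional using (Unique)
open import Data.Product using (_×_)

-- Propositional variables: the infinite set U is represented by ℕ.
data Formula : Set where
  var  : ℕ → Formula
  ¬ᶠ_  : Formula → Formula
  _∧ᶠ_ : Formula → Formula → Formula
  _∨ᶠ_ : Formula → Formula → Formula
  _×⃗_  : Formula → Formula → Formula

opt : Formula → ℕ
opt (var a)   = 1
opt (¬ᶠ F)    = 1
opt (F ∧ᶠ G)  = opt F ⊔ opt G
opt (F ∨ᶠ G)  = opt F ⊔ opt G
opt (F ×⃗ G)  = opt F + opt G

data Player : Set where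
  P O : Player

-- Outcomes = leaves of the game tree T(Q:F), identified by their position
-- (path from the root). The shape of T(Q:F) does not depend on Q.
data Outcome : Formula → Set where
  leaf  : ∀ {a} → Outcome (var a)
  neg   : ∀ {G} → Outcome G → Outcome (¬ᶠ G)
  ∧l    : ∀ {G₁ G₂} → Outcome G₁ → Outcome (G₁ ∧ᶠ G₂)
  ∧r    : ∀ {G₁ G₂} → Outcome G₂ → Outcome (G₁ ∧ᶠ G₂)
  ∨l    : ∀ {G₁ G₂} → Outcome G₁ → Outcome (G₁ ∨ᶠ G₂)
  ∨r    : ∀ {G₁ G₂} → Outcome G₂ → Outcome (G₁ ∨ᶠ G₂)
  ×l    : ∀ {G₁ G₂} → Outcome G₁ → Outcome (G₁ ×⃗ G₂)
  ×r    : ∀ {G₁ G₂} → Outcome G₂ → Outcome (G₁ ×⃗ G₂)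

Pref : (Q : Player) (F : Formula) → Outcome F → Outcome F → Set
Pref O _ _ _ = ⊥
Pref P (var a) _ _ = ⊥
Pref P (¬ᶠ G) _ _ = ⊥
Pref P (G₁ ∧ᶠ G₂) (∧l x) (∧l y) = Pref P G₁ x y
Pref P (G₁ ∧ᶠ G₂) (∧r x) (∧r y) = Pref P G₂ x y
Pref P (G₁ ∧ᶠ G₂) _ _ = ⊥
Pref P (G₁ ∨ᶠ G₂) (∨l x) (∨l y) = Pref P G₁ x y
Pref P (G₁ ∨ᶠ G₂) (∨r x) (∨r y) = Pref P G₂ x y
Pref P (G₁ ∨ᶠ G₂) _ _ = ⊥
Pref P (G₁ ×⃗ G₂) (×l x) (×l y) = Pref P G₁ x y
Pref P (G₁ ×⃗ G₂) (×r x) (×r y) = Pref P G₂ x y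
Pref P (G₁ ×⃗ G₂) (×r x) (×l y) = ⊤
Pref P (G₁ ×⃗ G₂) (×l x) (×r y) = ⊥

IsChain : (F : Formula) → List (Outcome F) → Set
IsChain F os = Unique os × Linked (Pref P F) os

{-# OPTIONS --safe #-}
-- Outcomes of T(P:F) carry a rank in [0, opt F): a left outcome of G₁ ×⃗ G₂
-- is shifted above every outcome of G₂, all other connectives keep the rank of
-- the subtree. Every preference strictly increases the rank, so a chain has at
-- most opt F elements and is automatically repetition-free. Conversely, a
-- chain of length opt F is assembled recursively: for ∧ and ∨ take the longer
-- of the two subchains, for G₁ ×⃗ G₂ put the chain of G₂ before that of G₁.
module Submission where

open import Defs
open import Level using (Level)
open import Data.Nat using (ℕ; suc; _≤_; _<_; _+_; _⊔_; z≤n; s≤s)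
open import Data.Nat.Properties
open import Data.List using (List; []; _∷_; length; map; _++_)
open import Data.List.Properties using (length-map; length-++)
open import Data.List.Relation.Unary.Linked as Linked using (Linked; []; [-]; _∷_)
open import Data.List.Relation.Unary.Linked.Properties using (map⁺; Linked⇒AllPairs)
import Data.List.Relation.Unary.AllPairs as AllPairs
open import Data.List.Relation.Unary.Unique.Propositional using (Unique)
open import Data.Product using (Σ; _×_; _,_)
open import Data.Sum using (inj₁; inj₂)
open import Data.Unit using (tt)
open import Function using (_on_; id)
open import Relation.Binary using (Rel; _⇒_)
open import Relation.Binary.PropositionalEquality
  using (_≡_; refl; cong; cong₂; sym; trans; subst; module ≡-Reasoning)

module _ {a ℓ : Level} {A : Set a} {R : Rel A ℓ}
         (f : A → ℕ) (f-mono : R ⇒ (_<_ on f)) where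

  Linked⇒Unique : ∀ {xs} → Linked R xs → Unique xs
  Linked⇒Unique l =
    AllPairs.map (λ f[x]<f[y] x≡y → <-irrefl (cong f x≡y) f[x]<f[y])
                 (Linked⇒AllPairs <-trans (Linked.map f-mono l))

  module _ {m : ℕ} (f-< : ∀ x → f x < m) where

    length-linked-from : ∀ {x xs} → Linked R (x ∷ xs) → length xs + suc (f x) ≤ m
    length-linked-from {x} [-] = f-< x
    length-linked-from {x} {_ ∷ xs} (r ∷ l) = begin
      suc (length xs + suc (f x)) ≡⟨ +-suc (length xs) (suc (f x)) ⟨
      length xs + suc (suc (f x)) ≤⟨ +-monoʳ-≤ (length xs) (s≤s (f-mono r)) ⟩
      length xs + suc (f _)       ≤⟨ length-linked-from l ⟩
      m                           ∎
      where open ≤-Reasoning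

    length-linked≤ : ∀ {xs} → Linked R xs → length xs ≤ m
    length-linked≤ []         = z≤n
    length-linked≤ {x ∷ xs} l = begin
      suc (length xs)         ≤⟨ s≤s (m≤m+n (length xs) (f x)) ⟩
      suc (length xs + f x)   ≡⟨ +-suc (length xs) (f x) ⟨
      length xs + suc (f x)   ≤⟨ length-linked-from l ⟩
      m                       ∎
      where open ≤-Reasoning

rank : ∀ {F} → Outcome F → ℕ
rank leaf             = 0
rank (neg _)          = 0
rank (∧l x)           = rank x
rank (∧r x)           = rank x
rank (∨l x)           = rank x
rank (∨r x)           = rank x
rank (×l {G₂ = G₂} x) = rank x + opt G₂
rank (×r x)           = rank x

rank<opt : ∀ {F} (o : Outcome F) → rank o < opt F
rank<opt leaf             = s≤s z≤n
rank<opt (neg _)          = s≤s z≤n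
rank<opt (∧l x)           = <-≤-trans (rank<opt x) (m≤m⊔n _ _)
rank<opt (∧r x)           = <-≤-trans (rank<opt x) (m≤n⊔m _ _)
rank<opt (∨l x)           = <-≤-trans (rank<opt x) (m≤m⊔n _ _)
rank<opt (∨r x)           = <-≤-trans (rank<opt x) (m≤n⊔m _ _)
rank<opt (×l {G₂ = G₂} x) = +-monoˡ-< (opt G₂) (rank<opt x)
rank<opt (×r {G₁ = G₁} x) = <-≤-trans (rank<opt x) (m≤n+m _ (opt G₁))

Pref⇒rank< : ∀ {F} → Pref P F ⇒ (_<_ on rank)
Pref⇒rank< {x = leaf}  {leaf}  ()
Pref⇒rank< {x = neg _} {neg _} ()
Pref⇒rank< {x = ∧l x}  {∧l y}  p  = Pref⇒rank< {x = x} {y} p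
Pref⇒rank< {x = ∧r x}  {∧r y}  p  = Pref⇒rank< {x = x} {y} p
Pref⇒rank< {x = ∨l x}  {∨l y}  p  = Pref⇒rank< {x = x} {y} p
Pref⇒rank< {x = ∨r x}  {∨r y}  p  = Pref⇒rank< {x = x} {y} p
Pref⇒rank< {x = ×l x}  {×l y}  p  = +-monoˡ-< _ (Pref⇒rank< {x = x} {y} p)
Pref⇒rank< {x = ×r x}  {×r y}  p  = Pref⇒rank< {x = x} {y} p
Pref⇒rank< {x = ×r x}  {×l y}  tt = <-≤-trans (rank<opt x) (m≤n+m _ (rank y))

LinkedChain : (F : Formula) → ℕ → Set
LinkedChain F n = Σ (List (Outcome F)) λ os → Linked (Pref P F) os × length os ≡ n

map-chain : ∀ {F G n} (ι : Outcome G → Outcome F) → Pref P G ⇒ (Pref P F on ι) →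
            LinkedChain G n → LinkedChain F n
map-chain ι pres (os , l , len) = map ι os , map⁺ (Linked.map pres l) , trans (length-map ι os) len

chain-⊔ : ∀ {F m n} → LinkedChain F m → LinkedChain F n → LinkedChain F (m ⊔ n)
chain-⊔ {F} {m} {n} c d with ⊔-sel m n
... | inj₁ m⊔n≡m = subst (LinkedChain F) (sym m⊔n≡m) c
... | inj₂ m⊔n≡n = subst (LinkedChain F) (sym m⊔n≡n) d

module _ {G₁ G₂ : Formula} where

  linked-×⃗ : ∀ {xs ys} → Linked (Pref P G₂) xs → Linked (Pref P G₁) ys →
              Linked (Pref P (G₁ ×⃗ G₂)) (map ×r xs ++ map ×l ys)
  linked-×⃗                []       ly = map⁺ ly
  linked-×⃗ {ys = []}      [-]      _  = [-]
  linked-×⃗ {ys = _ ∷ _}   [-]      ly = tt ∷ map⁺ ly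
  linked-×⃗                (p ∷ lx) ly = p ∷ linked-×⃗ lx ly

  chain-×⃗ : ∀ {m n} → LinkedChain G₁ m → LinkedChain G₂ n → LinkedChain (G₁ ×⃗ G₂) (m + n)
  chain-×⃗ {m} {n} (ys , ly , len-ys) (xs , lx , len-xs) =
    map ×r xs ++ map ×l ys , linked-×⃗ lx ly , (begin
      length (map ×r xs ++ map ×l ys)           ≡⟨ length-++ (map ×r xs) ⟩
      length (map ×r xs) + length (map ×l ys)   ≡⟨ cong₂ _+_ (length-map ×r xs) (length-map ×l ys) ⟩
      length xs + length ys                     ≡⟨ cong₂ _+_ len-xs len-ys ⟩
      n + m                                     ≡⟨ +-comm n m ⟩
      m + n                                     ∎)
    where open ≡-Reasoning

inhabitant : (F : Formula) → Outcome F
inhabitant (var _)  = leaf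
inhabitant (¬ᶠ G)   = neg (inhabitant G)
inhabitant (G ∧ᶠ _) = ∧l (inhabitant G)
inhabitant (G ∨ᶠ _) = ∨l (inhabitant G)
inhabitant (G ×⃗ _)  = ×l (inhabitant G)

longest-chain : (F : Formula) → LinkedChain F (opt F)
longest-chain (var _)    = leaf ∷ [] , [-] , refl
longest-chain (¬ᶠ G)     = neg (inhabitant G) ∷ [] , [-] , refl
longest-chain (G₁ ∧ᶠ G₂) = chain-⊔ (map-chain ∧l id (longest-chain G₁)) (map-chain ∧r id (longest-chain G₂))
longest-chain (G₁ ∨ᶠ G₂) = chain-⊔ (map-chain ∨l id (longest-chain G₁)) (map-chain ∨r id (longest-chain G₂))
longest-chain (G₁ ×⃗ G₂)  = chain-×⃗ (longest-chain G₁) (longest-chain G₂)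

lemma3 : (F : Formula) →
    Σ (List (Outcome F)) (λ os → IsChain F os × length os ≡ opt F)
    × ((os : List (Outcome F)) → IsChain F os → length os ≤ opt F)
lemma3 F with longest-chain F
... | os , linked , len =
  (os , (Linked⇒Unique rank (Pref⇒rank< {F}) linked , linked) , len) ,
  λ _ (_ , linked′) → length-linked≤ rank (Pref⇒rank< {F}) rank<opt linked′
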